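{- Let $E$ be a finite set and $\tau:2^{E}\to2^{E}$ an operator satisfying (C1) $X\subseteq\tau(X)$ for all $X\subseteq E$, and (C22) for all $F\subseteq G\subseteq E$ with $G\subseteq\tau(F)$, $\tau(G)=\tau(F)$ (i.e. $(E,\tau)$ is a violator space). For $X\subseteq E$ let $ex(X)=\{x\in X: x\notin\tau(X\setminus\{x\})\}$ be the set of extreme points of $X$. Then $(E,\tau)$ is uniquely generated if and only if $\tau(X)=\tau(ex(X))$ for every $X\subseteq E$.
   Context: Standing convention: generators and bases of a set $X$ are taken to be subsets of $X$. That is, a generator of $X$ is a set $B\subseteq X$ with $\tau(B)=\tau(X)$, a basis of $X$ is an inclusion-minimal generator of $X$, and $(E,\tau)$ is uniquely generated if every $X\subseteq E$ has exactly one basis. -}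

module Defs where

open import Data.Nat using (ℕ)
open import Data.Bool using (Bool; true; false; _∧_; not)
open import Data.Fin using (Fin)
open import Data.Fin.Subset using (Subset; _⊆_; _-_)
open import Data.Vec using (lookup; tabulate)
open import Data.Product using (Σ; _×_)
open import Relation.Binary.PropositionalEquality using (_≡_)

-- The ground set E is Fin n; subsets of E are Data.Fin.Subset n.
-- An operator τ : 2^E → 2^E is a function Subset n → Subset n.

C1 : ∀ {n} → (Subset n → Subset n) → Set
C1 {n} τ = ∀ (X : Subset n) → X ⊆ τ X

C22 : ∀ {n} → (Subset n → Subset n) → Set
C22 {n} τ = ∀ (F G : Subset n) → F ⊆ G → G ⊆ τ F → τ G ≡ τ F

IsViolatorSpace : ∀ {n} → (Subset n → Subset n) → Set
IsViolatorSpace τ = C1 τ × C22 τ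

ex : ∀ {n} → (Subset n → Subset n) → Subset n → Subset n
ex τ X = tabulate (λ x → lookup X x ∧ not (lookup (τ (X - x)) x))

IsGenerator : ∀ {n} → (Subset n → Subset n) → Subset n → Subset n → Set
IsGenerator τ X B = B ⊆ X × τ B ≡ τ X

IsBasis : ∀ {n} → (Subset n → Subset n) → Subset n → Subset n → Set
IsBasis {n} τ X B =
  IsGenerator τ X B × (∀ (B′ : Subset n) → B′ ⊆ B → IsGenerator τ X B′ → B′ ≡ B)

UniquelyGenerated : ∀ {n} → (Subset n → Subset n) → Set
UniquelyGenerated {n} τ =
  ∀ (X : Subset n) → Σ (Subset n) (λ B → IsBasis τ X B × (∀ (B′ : Subset n) → IsBasis τ X B′ → B′ ≡ B))

-- Every generator B of X contains ex(X): if an extreme point x were missing from B, then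
-- B ⊆ X ∖ x ⊆ X ⊆ τ(B), so (C22) would give τ(X ∖ x) = τ(X) ∋ x. Hence when τ(X) = τ(ex(X)),
-- ex(X) is the least generator of X and so its unique basis. Conversely, if a point x of the
-- unique basis B of X were not extreme, then τ(X ∖ x) = τ(X), so the basis of X ∖ x is also a
-- basis of X; it equals B by uniqueness, yet it avoids x. Thus B ⊆ ex(X) ⊆ B.
module Submission where

open import Defs
open import Data.Nat using (ℕ)
open import Data.Bool using (true; false; _∧_; not)
open import Data.Fin using (Fin; zero; suc; _≟_)
open import Data.Fin.Subset using (Subset; _∈_; _∉_; _⊆_; _-_)
open import Data.Fin.Subset.Properties using (⊆-antisym; ⊆-trans; p─q⊆p; x∈p∧x≢y⇒x∈p-y; _∈?_)
open import Data.Vec using (_∷_; lookup)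
open import Data.Vec.Properties using ([]=⇒lookup; lookup⇒[]=; lookup∘tabulate)
open import Data.Vec.Base using (there)
open import Data.Product using (_×_; _,_; proj₁; proj₂)
open import Function.Bundles using (_⇔_; mk⇔; Equivalence)
open import Function.Properties.Equivalence using (⇔-setoid) renaming (sym to ⇔-sym)
open import Function.Related.TypeIsomorphisms using (¬-cong-⇔)
open import Data.Product.Function.NonDependent.Propositional using (_×-⇔_)
open import Level using (0ℓ)
import Relation.Binary.Reasoning.Setoid as SetoidReasoning
open import Relation.Binary.PropositionalEquality using (_≡_; refl; sym; trans; cong; subst)
open import Relation.Nullary using (¬_; yes; no; contradiction)

x∉p-x : ∀ {n} (p : Subset n) (x : Fin n) → x ∉ p - x
x∉p-x (_ ∷ p) zero    ()
x∉p-x (_ ∷ p) (suc x) (there x∈p-x) = x∉p-x p x x∈p-x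

∧-not≡true⇔ : ∀ a b → (a ∧ not b ≡ true) ⇔ (a ≡ true × ¬ b ≡ true)
∧-not≡true⇔ true  false = mk⇔ (λ _ → refl , λ ()) (λ _ → refl)
∧-not≡true⇔ true  true  = mk⇔ (λ ()) (λ (_ , b≢true) → contradiction refl b≢true)
∧-not≡true⇔ false b     = mk⇔ (λ ()) (λ ())

x∈p⇔lookup≡true : ∀ {n} {p : Subset n} {x : Fin n} → x ∈ p ⇔ lookup p x ≡ true
x∈p⇔lookup≡true = mk⇔ []=⇒lookup (lookup⇒[]= _ _)

x∈ex⇔ : ∀ {n} (τ : Subset n → Subset n) (X : Subset n) (x : Fin n) →
        x ∈ ex τ X ⇔ (x ∈ X × x ∉ τ (X - x))
x∈ex⇔ τ X x = begin
  x ∈ ex τ X                                           ≈⟨ x∈p⇔lookup≡true ⟩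
  lookup (ex τ X) x ≡ true                              ≡⟨ cong (_≡ true) (lookup∘tabulate _ x) ⟩
  lookup X x ∧ not (lookup (τ (X - x)) x) ≡ true        ≈⟨ ∧-not≡true⇔ _ _ ⟩
  (lookup X x ≡ true × ¬ lookup (τ (X - x)) x ≡ true)   ≈⟨ ⇔-sym membership ⟩
  (x ∈ X × x ∉ τ (X - x))                               ∎
  where
  membership : (x ∈ X × x ∉ τ (X - x)) ⇔ (lookup X x ≡ true × ¬ lookup (τ (X - x)) x ≡ true)
  membership = x∈p⇔lookup≡true ×-⇔ ¬-cong-⇔ x∈p⇔lookup≡true
  open SetoidReasoning (⇔-setoid 0ℓ)

ex⊆X : ∀ {n} (τ : Subset n → Subset n) (X : Subset n) → ex τ X ⊆ X
ex⊆X τ X {x} x∈ex = proj₁ (Equivalence.to (x∈ex⇔ τ X x) x∈ex)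

basis-unique : ∀ {n} {τ : Subset n → Subset n} → UniquelyGenerated τ →
               ∀ {X B B′} → IsBasis τ X B → IsBasis τ X B′ → B ≡ B′
basis-unique ug {X} basisB basisB′ with ug X
... | _ , _ , unique = trans (unique _ basisB) (sym (unique _ basisB′))

module ViolatorSpace {n : ℕ} (τ : Subset n → Subset n) (c1 : C1 τ) (c22 : C22 τ) where

  x∈τ[X-x]⇒τ[X-x]≡τX : ∀ {X x} → x ∈ X → x ∈ τ (X - x) → τ (X - x) ≡ τ X
  x∈τ[X-x]⇒τ[X-x]≡τX {X} {x} x∈X x∈τ[X-x] = sym (c22 (X - x) X (p─q⊆p X _) X⊆τ[X-x])
    where
    X⊆τ[X-x] : X ⊆ τ (X - x)
    X⊆τ[X-x] {y} y∈X with y ≟ x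
    ... | yes refl = x∈τ[X-x]
    ... | no  y≢x  = c1 (X - x) (x∈p∧x≢y⇒x∈p-y y∈X y≢x)

  generator-⊆-≡τ : ∀ {X Y B} → IsGenerator τ X B → B ⊆ Y → Y ⊆ X → τ Y ≡ τ X
  generator-⊆-≡τ {X} {Y} {B} (_ , τB≡τX) B⊆Y Y⊆X =
    trans (c22 B Y B⊆Y (λ y∈Y → subst (_ ∈_) (sym τB≡τX) (c1 X (Y⊆X y∈Y)))) τB≡τX

  ex⊆generator : ∀ {X B} → IsGenerator τ X B → ex τ X ⊆ B
  ex⊆generator {X} {B} gen@(B⊆X , _) {x} x∈ex with x ∈? B
  ... | yes x∈B = x∈B
  ... | no  x∉B = contradiction x∈τ[X-x] x∉τ[X-x]
    where
    x∉τ[X-x] : x ∉ τ (X - x)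
    x∉τ[X-x] = proj₂ (Equivalence.to (x∈ex⇔ τ X x) x∈ex)
    B⊆X-x : B ⊆ X - x
    B⊆X-x {y} y∈B = x∈p∧x≢y⇒x∈p-y (B⊆X y∈B) λ { refl → x∉B y∈B }
    x∈τ[X-x] : x ∈ τ (X - x)
    x∈τ[X-x] = subst (x ∈_) (sym (generator-⊆-≡τ gen B⊆X-x (p─q⊆p X _))) (c1 X (ex⊆X τ X x∈ex))

  basis-⊆-≡τ : ∀ {X Y B} → Y ⊆ X → τ Y ≡ τ X → IsBasis τ Y B → IsBasis τ X B
  basis-⊆-≡τ Y⊆X τY≡τX ((B⊆Y , τB≡τY) , minimal) =
    (⊆-trans B⊆Y Y⊆X , trans τB≡τY τY≡τX) ,
    λ B′ B′⊆B (_ , τB′≡τX) → minimal B′ B′⊆B (⊆-trans B′⊆B B⊆Y , trans τB′≡τX (sym τY≡τX))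

  basis⊆ex : UniquelyGenerated τ → ∀ {X B} → IsBasis τ X B → B ⊆ ex τ X
  basis⊆ex ug {X} {B} basisB@((B⊆X , _) , _) {x} x∈B =
    Equivalence.from (x∈ex⇔ τ X x) (B⊆X x∈B , x∉τ[X-x])
    where
    x∉τ[X-x] : x ∉ τ (X - x)
    x∉τ[X-x] x∈τ[X-x] with ug (X - x)
    ... | B′ , basisB′@((B′⊆X-x , _) , _) , _ = x∉p-x X x (B′⊆X-x (subst (x ∈_) B≡B′ x∈B))
      where
      B≡B′ : B ≡ B′
      B≡B′ = basis-unique ug basisB
        (basis-⊆-≡τ (p─q⊆p X _) (x∈τ[X-x]⇒τ[X-x]≡τX (B⊆X x∈B) x∈τ[X-x]) basisB′)

  uniquelyGenerated⇒τ≡τ∘ex : UniquelyGenerated τ → ∀ X → τ X ≡ τ (ex τ X)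
  uniquelyGenerated⇒τ≡τ∘ex ug X with ug X
  ... | _ , basisB@(genB@(_ , τB≡τX) , _) , _ =
    subst (λ Y → τ X ≡ τ Y) (⊆-antisym (basis⊆ex ug basisB) (ex⊆generator genB)) (sym τB≡τX)

  τ≡τ∘ex⇒uniquelyGenerated : (∀ X → τ X ≡ τ (ex τ X)) → UniquelyGenerated τ
  τ≡τ∘ex⇒uniquelyGenerated τ≡τ∘ex X = ex τ X , (genEx , minimal) , unique
    where
    genEx : IsGenerator τ X (ex τ X)
    genEx = ex⊆X τ X , sym (τ≡τ∘ex X)
    minimal : ∀ B → B ⊆ ex τ X → IsGenerator τ X B → B ≡ ex τ X
    minimal B B⊆ex genB = ⊆-antisym B⊆ex (ex⊆generator genB)
    unique : ∀ B → IsBasis τ X B → B ≡ ex τ X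
    unique B (genB , minimalB) = sym (minimalB (ex τ X) (ex⊆generator genB) genEx)

mainTheorem2 : (n : ℕ) → (τ : Subset n → Subset n) → IsViolatorSpace τ →
    (UniquelyGenerated τ → ((X : Subset n) → τ X ≡ τ (ex τ X))) ×
    (((X : Subset n) → τ X ≡ τ (ex τ X)) → UniquelyGenerated τ)
mainTheorem2 n τ (c1 , c22) = uniquelyGenerated⇒τ≡τ∘ex , τ≡τ∘ex⇒uniquelyGenerated
  where open ViolatorSpace τ c1 c22
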